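{- For every sequent $\Gamma\Rightarrow\delta$ of first-order arithmetic: if $\mathrm{CHA}\vdash\Gamma\Rightarrow\delta$ then $\omega\vDash\Gamma\Rightarrow\delta$, i.e. every assignment $\rho$ of natural numbers to (at least) the free variables of $\Gamma,\delta$ that satisfies all formulas of $\Gamma$ in the standard model also satisfies $\delta$.
   Context: Language: terms from variables, $0,S,+,\cdot$; formulas from $s=t,\bot,\wedge,\vee,\to,\forall,\exists$, interpreted in the standard model $\omega$ of the natural numbers. Sequents $\Gamma\Rightarrow\delta$: finite set $\Gamma$, single formula $\delta$. $\mathrm{CHA}$: sequent calculus with the standard intuitionistic rules Ax ($\Gamma,\delta\Rightarrow\delta$), $\to$L/R, $\wedge$L/R, $\vee$L/R, $\forall$L/R, $\exists$L/R (usual eigenvariable conditions), $\bot$L, $=$L (from $\Gamma[x/y]\Rightarrow\delta[x/y]$ infer $\Gamma[s/x,t/y],s=t\Rightarrow\delta[s/x,t/y]$, $x,y\notin\mathrm{FV}(s,t)$), $=$R, weakening, cut, arithmetic axioms $\Rightarrow 0\neq St$, $Ss=St\Rightarrow s=t$, $\Rightarrow s+0=s$, $\Rightarrow s+St=S(s+t)$, $\Rightarrow s\cdot0=0$, $\Rightarrow s\cdot St=(s\cdot t)+s$, and $\textsc{Case}_x$ (from $\Gamma[0/x]\Rightarrow\delta[0/x]$ and $\Gamma[Sx/x]\Rightarrow\delta[Sx/x]$ infer $\Gamma\Rightarrow\delta$). A pre-proof is a finite tree with a partial map $\beta$ sending some leaves (buds) to inner nodes (companions); non-bud nodes carry rule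 instances whose premises label the children; buds carry their companion's sequent. An infinite branch starts at the root and each step goes to a child or from a bud to its companion. A $\mathrm{CHA}$-proof is a pre-proof such that along every infinite branch some variable $x$ is, from some point on, free in every sequent of the branch and the branch passes instances of $\textsc{Case}_x$ infinitely often. $\mathrm{CHA}\vdash\Gamma\Rightarrow\delta$ means some $\mathrm{CHA}$-proof has root labelled $\Gamma\Rightarrow\delta$. -}

module Defs where

open import Data.Nat using (ℕ; zero; suc; _+_; _*_; _≤_; _≟_)
open import Data.List using (List; []; _∷_; map; _++_)
open import Data.List.Relation.Unary.All using (All)
open import Data.List.Relation.Unary.Any using (Any)
open import Data.List.Relation.Binary.Subset.Propositional using (_⊆_)
open import Data.Maybe using (Maybe; just; nothing)
open import Data.Product using (Σ; ∃; _×_; _,_)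
open import Data.Sum using (_⊎_)
open import Data.Empty using (⊥)
open import Relation.Nullary using (¬_; yes; no)
open import Relation.Binary.PropositionalEquality using (_≡_; _≢_)

-- Syntax of first-order arithmetic (de Bruijn indices for bound
-- variables; a free variable is a natural number ℕ).

infix  6 _≐_
infixr 5 _∧'_
infixr 4 _∨'_
infixr 3 _⊃_

data Term : Set where
  var  : ℕ → Term
  zer  : Term
  S    : Term → Term
  _+'_ : Term → Term → Term
  _·_  : Term → Term → Term

data Formula : Set where
  _≐_  : Term → Term → Formula
  ⊥'   : Formula
  _∧'_ : Formula → Formula → Formula
  _∨'_ : Formula → Formula → Formula
  _⊃_  : Formula → Formula → Formula
  ∀'   : Formula → Formula
  ∃'   : Formula → Formula

infix 2 _⊢_
record Seq : Set where
  constructor _⊢_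
  field
    ante : List Formula
    succ : Formula
open Seq public

renT : (ℕ → ℕ) → Term → Term
renT r (var x)  = var (r x)
renT r zer      = zer
renT r (S t)    = S (renT r t)
renT r (s +' t) = renT r s +' renT r t
renT r (s · t)  = renT r s · renT r t

Subst : Set
Subst = ℕ → Term

ext : Subst → Subst
ext σ zero    = var zero
ext σ (suc n) = renT suc (σ n)

substT : Subst → Term → Term
substT σ (var x)  = σ x
substT σ zer      = zer
substT σ (S t)    = S (substT σ t)
substT σ (s +' t) = substT σ s +' substT σ t
substT σ (s · t)  = substT σ s · substT σ t

substF : Subst → Formula → Formula
substF σ (s ≐ t)  = substT σ s ≐ substT σ t
substF σ ⊥'       = ⊥'
substF σ (φ ∧' ψ) = substF σ φ ∧' substF σ ψ
substF σ (φ ∨' ψ) = substF σ φ ∨' substF σ ψ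
substF σ (φ ⊃ ψ)  = substF σ φ ⊃ substF σ ψ
substF σ (∀' φ)   = ∀' (substF (ext σ) φ)
substF σ (∃' φ)   = ∃' (substF (ext σ) φ)

substL : Subst → List Formula → List Formula
substL σ = map (substF σ)

sub1 : ℕ → Term → Subst
sub1 x t y with y ≟ x
... | yes _ = t
... | no  _ = var y

sub2 : ℕ → Term → ℕ → Term → Subst
sub2 x s y t z with z ≟ x
... | yes _ = s
... | no  _ with z ≟ y
...   | yes _ = t
...   | no  _ = var z

-- instantiate the bound variable of a quantifier body: φ[t/x] for ∀xφ / ∃xφ
inst0 : Term → Subst
inst0 t zero    = t
inst0 t (suc n) = var n

inst : Formula → Term → Formula
inst φ t = substF (inst0 t) φ

FreeT : ℕ → Term → Set
FreeT x (var y)  = x ≡ y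
FreeT x zer      = ⊥
FreeT x (S t)    = FreeT x t
FreeT x (s +' t) = FreeT x s ⊎ FreeT x t
FreeT x (s · t)  = FreeT x s ⊎ FreeT x t

Free : ℕ → Formula → Set
Free x (s ≐ t)  = FreeT x s ⊎ FreeT x t
Free x ⊥'       = ⊥
Free x (φ ∧' ψ) = Free x φ ⊎ Free x ψ
Free x (φ ∨' ψ) = Free x φ ⊎ Free x ψ
Free x (φ ⊃ ψ)  = Free x φ ⊎ Free x ψ
Free x (∀' φ)   = Free (suc x) φ
Free x (∃' φ)   = Free (suc x) φ

FreeL : ℕ → List Formula → Set
FreeL x Γ = Any (Free x) Γ

FreeSeq : ℕ → Seq → Set
FreeSeq x (Γ ⊢ δ) = FreeL x Γ ⊎ Free x δ

data Tag : Set where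
  ax botL eqR eqL impL impR andL andR orL orR₁ orR₂
    allL allR exL exR wk cut
    zeroNeS sInj plus0 plusS times0 timesS : Tag
  case : ℕ → Tag

data Inst : Tag → List Seq → Seq → Set where
  ax   : ∀ {Γ δ} → Inst ax [] ((δ ∷ Γ) ⊢ δ)
  botL : ∀ {Γ δ} → Inst botL [] ((⊥' ∷ Γ) ⊢ δ)
  eqR  : ∀ {Γ t} → Inst eqR [] (Γ ⊢ t ≐ t)
  eqL  : ∀ {Γ δ s t x y} → x ≢ y →
         ¬ FreeT x s → ¬ FreeT x t → ¬ FreeT y s → ¬ FreeT y t →
         Inst eqL ((substL (sub1 y (var x)) Γ ⊢ substF (sub1 y (var x)) δ) ∷ [])
                  (((s ≐ t) ∷ substL (sub2 x s y t) Γ) ⊢ substF (sub2 x s y t) δ)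
  impL : ∀ {Γ φ ψ δ} → Inst impL ((Γ ⊢ φ) ∷ ((ψ ∷ Γ) ⊢ δ) ∷ []) (((φ ⊃ ψ) ∷ Γ) ⊢ δ)
  impR : ∀ {Γ φ ψ} → Inst impR (((φ ∷ Γ) ⊢ ψ) ∷ []) (Γ ⊢ φ ⊃ ψ)
  andL : ∀ {Γ φ ψ δ} → Inst andL (((φ ∷ ψ ∷ Γ) ⊢ δ) ∷ []) (((φ ∧' ψ) ∷ Γ) ⊢ δ)
  andR : ∀ {Γ φ ψ} → Inst andR ((Γ ⊢ φ) ∷ (Γ ⊢ ψ) ∷ []) (Γ ⊢ φ ∧' ψ)
  orL  : ∀ {Γ φ ψ δ} → Inst orL (((φ ∷ Γ) ⊢ δ) ∷ ((ψ ∷ Γ) ⊢ δ) ∷ []) (((φ ∨' ψ) ∷ Γ) ⊢ δ)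
  orR₁ : ∀ {Γ φ ψ} → Inst orR₁ ((Γ ⊢ φ) ∷ []) (Γ ⊢ φ ∨' ψ)
  orR₂ : ∀ {Γ φ ψ} → Inst orR₂ ((Γ ⊢ ψ) ∷ []) (Γ ⊢ φ ∨' ψ)
  allL : ∀ {Γ φ δ} (t : Term) → Inst allL (((inst φ t ∷ Γ) ⊢ δ) ∷ []) ((∀' φ ∷ Γ) ⊢ δ)
  allR : ∀ {Γ φ} (y : ℕ) → ¬ FreeL y Γ → ¬ Free y (∀' φ) →
         Inst allR ((Γ ⊢ inst φ (var y)) ∷ []) (Γ ⊢ ∀' φ)
  exL  : ∀ {Γ φ δ} (y : ℕ) → ¬ FreeL y Γ → ¬ Free y (∃' φ) → ¬ Free y δ →
         Inst exL (((inst φ (var y) ∷ Γ) ⊢ δ) ∷ []) ((∃' φ ∷ Γ) ⊢ δ)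
  exR  : ∀ {Γ φ} (t : Term) → Inst exR ((Γ ⊢ inst φ t) ∷ []) (Γ ⊢ ∃' φ)
  wk   : ∀ {Γ Γ' δ} → Γ ⊆ Γ' → Inst wk ((Γ ⊢ δ) ∷ []) (Γ' ⊢ δ)
  cut  : ∀ {Γ φ δ} → Inst cut ((Γ ⊢ φ) ∷ ((φ ∷ Γ) ⊢ δ) ∷ []) (Γ ⊢ δ)
  zeroNeS : ∀ {t} → Inst zeroNeS [] ([] ⊢ (zer ≐ S t) ⊃ ⊥')
  sInj    : ∀ {s t} → Inst sInj [] (((S s ≐ S t) ∷ []) ⊢ s ≐ t)
  plus0   : ∀ {s} → Inst plus0 [] ([] ⊢ (s +' zer) ≐ s)
  plusS   : ∀ {s t} → Inst plusS [] ([] ⊢ (s +' S t) ≐ S (s +' t))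
  times0  : ∀ {s} → Inst times0 [] ([] ⊢ (s · zer) ≐ zer)
  timesS  : ∀ {s t} → Inst timesS [] ([] ⊢ (s · S t) ≐ ((s · t) +' s))
  caseR   : ∀ {Γ δ} (x : ℕ) →
            Inst (case x)
              ((substL (sub1 x zer) Γ ⊢ substF (sub1 x zer) δ) ∷
               (substL (sub1 x (S (var x))) Γ ⊢ substF (sub1 x (S (var x))) δ) ∷ [])
              (Γ ⊢ δ)

-- Pre-proofs: finite trees; a bud carries a sequent and the address
-- (path of child indices from the root) of its companion.

data PTree : Set where
  bud  : Seq → List ℕ → PTree
  node : Seq → Tag → List PTree → PTree

label : PTree → Seq
label (bud s _)    = s
label (node s _ _) = s

Address : Set
Address = List ℕ

mutual
  at : PTree → Address → Maybe PTree
  at t            []      = just t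
  at (bud _ _)    (_ ∷ _) = nothing
  at (node _ _ ts) (j ∷ a) = atList ts j a

  atList : List PTree → ℕ → Address → Maybe PTree
  atList []       _       _ = nothing
  atList (t ∷ ts) zero    a = at t a
  atList (t ∷ ts) (suc j) a = atList ts j a

-- Local correctness of a pre-proof with root `root`:
-- every non-bud node is a rule instance whose premises label its
-- children; every bud's companion is an inner node of the tree with
-- the same sequent.
data WF (root : PTree) : PTree → Set where
  budWF  : ∀ {s a} →
           (∃ λ r → ∃ λ t → ∃ λ ts → at root a ≡ just (node s r (t ∷ ts))) →
           WF root (bud s a)
  nodeWF : ∀ {s r ts} → Inst r (map label ts) s → All (WF root) ts →
           WF root (node s r ts)

-- One step of a branch: to a child, or from a bud to its companion.
Next : PTree → Address → Address → Set
Next root a b =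
  (∃ λ j → b ≡ a ++ (j ∷ []) × ∃ λ t → at root b ≡ just t)
  ⊎ (∃ λ s → at root a ≡ just (bud s b))

InfBranch : PTree → (ℕ → Address) → Set
InfBranch root f = f 0 ≡ [] × (∀ i → Next root (f i) (f (suc i)))

-- Global trace condition along a branch: some variable x is free in
-- every sequent from some point on, and Case_x is passed infinitely often.
GoodBranch : PTree → (ℕ → Address) → Set
GoodBranch root f =
  ∃ λ x →
    (∃ λ N → ∀ i → N ≤ i → ∃ λ t → at root (f i) ≡ just t × FreeSeq x (label t))
    × (∀ M → ∃ λ i → M ≤ i × ∃ λ s → ∃ λ ts → at root (f i) ≡ just (node s (case x) ts))

CHAProof : PTree → Set
CHAProof π = WF π π × (∀ f → InfBranch π f → GoodBranch π f)

_⊢CHA_ : List Formula → Formula → Set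
Γ ⊢CHA δ = ∃ λ π → label π ≡ (Γ ⊢ δ) × CHAProof π

Env : Set
Env = ℕ → ℕ

_∷ₑ_ : ℕ → Env → Env
(n ∷ₑ ρ) zero    = n
(n ∷ₑ ρ) (suc k) = ρ k

evalT : Env → Term → ℕ
evalT ρ (var x)  = ρ x
evalT ρ zer      = zero
evalT ρ (S t)    = suc (evalT ρ t)
evalT ρ (s +' t) = evalT ρ s + evalT ρ t
evalT ρ (s · t)  = evalT ρ s * evalT ρ t

Sat : Env → Formula → Set
Sat ρ (s ≐ t)  = evalT ρ s ≡ evalT ρ t
Sat ρ ⊥'       = ⊥
Sat ρ (φ ∧' ψ) = Sat ρ φ × Sat ρ ψ
Sat ρ (φ ∨' ψ) = Sat ρ φ ⊎ Sat ρ ψ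
Sat ρ (φ ⊃ ψ)  = Sat ρ φ → Sat ρ ψ
Sat ρ (∀' φ)   = (n : ℕ) → Sat (n ∷ₑ ρ) φ
Sat ρ (∃' φ)   = Σ ℕ λ n → Sat (n ∷ₑ ρ) φ

_⊨ω_ : List Formula → Formula → Set
Γ ⊨ω δ = (ρ : Env) → All (Sat ρ) Γ → Sat ρ δ

-- Validity is proved by well-founded induction instead of the classical infinite descent.
-- Local soundness shows that the conclusion of every rule holds at ρ as soon as each premise
-- holds at every ρ' reachable by a "traced" change: no free variable grows, and the Case
-- variable strictly drops when it stays free. It therefore suffices that traced steps between
-- reachable nodes of the pre-proof admit no infinite chain. Going round a reachable cycle
-- forever is an infinite branch, so the global trace condition makes each cycle strictly
-- decrease some variable; cycles at a node compose, so by the size-change principle the returns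
-- to a single node are well founded, and eliminating the finitely many nodes one at a time makes
-- all traced steps well founded.

module Submission where

open import Defs

open import Data.Empty using (⊥-elim)
open import Data.Fin as Fin using (Fin; toℕ; fromℕ<)
open import Data.Fin.Properties using (all?; ¬∀⟶∃¬; toℕ-fromℕ<)
open import Data.List using (List; []; _∷_; map; _++_)
open import Data.List.Membership.Propositional using (_∈_)
open import Data.List.Membership.Propositional.Properties using (∈-map⁺; ∈-++⁺ˡ; ∈-++⁺ʳ)
open import Data.List.Properties using () renaming (≡-dec to ≡-decᴸ)
open import Data.List.Relation.Unary.All using (All; []; _∷_)
open import Data.List.Relation.Unary.All.Properties using (anti-mono) renaming (map⁺ to All-map⁺)
open import Data.List.Relation.Unary.Any using (Any; here; there; any?)
open import Data.Maybe using (Maybe; just; nothing; maybe)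
open import Data.Maybe.Properties using (≡-dec)
open import Data.Maybe.Relation.Unary.Any as MaybeAny using (just; drop-just)
open import Data.Nat using (ℕ; zero; suc; _+_; _*_; _∸_; _≤_; _<_; _⊔_; _≟_; _≤?_; pred; z≤n; s≤s)
open import Data.Nat.Induction using (<-wellFounded)
open import Data.Nat.Properties
  using ( ≤-refl; ≤-reflexive; ≤-trans; <-trans; <-≤-trans; ≤-<-trans; <⇒≤; ≰⇒>; m≤n⇒m<n∨m≡n
        ; m≤m+n; m≤n+m; m≤m⊔n; m≤n⊔m; ⊔-lub; +-mono-≤; +-mono-<-≤; +-mono-≤-<; ∸-monoʳ-<
        ; m≤n⇒∃[o]m+o≡n
        ; suc-injective; +-identityʳ; +-suc; +-comm; *-zeroʳ; *-suc )
open import Data.Product using (Σ; ∃-syntax; _×_; _,_; proj₁; proj₂)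
open import Data.Product.Function.NonDependent.Propositional using (_×-⇔_)
open import Data.Sum using (_⊎_; inj₁; inj₂; [_,_]′) renaming (map to map⊎)
open import Data.Sum.Function.Propositional using (_⊎-⇔_)
open import Data.Unit using (⊤; tt)
open import Function using (_∘_; id; flip; _on_)
open import Function.Bundles using (_⇔_; mk⇔; module Equivalence)
open import Function.Related.TypeIsomorphisms using (→-cong-⇔)
open import Induction.WellFounded using (Acc; acc; WellFounded; module Subrelation)
open import Relation.Binary.Construct.Closure.ReflexiveTransitive using (Star; ε; _◅_; _◅◅_)
open import Relation.Binary.Construct.Closure.Transitive using (TransClosure; [_]; _∷_) renaming (_++_ to _++⁺_)
open import Relation.Binary.Construct.On as On using ()
open import Relation.Binary.Definitions using (DecidableEquality)
open import Relation.Binary.PropositionalEquality using (_≡_; _≢_; refl; sym; trans; cong; cong₂; subst)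
open import Relation.Nullary using (¬_; Dec; yes; no)
open import Relation.Nullary.Decidable using (_⊎-dec_; _×-dec_)

open Equivalence using (to; from)

freeT? : ∀ x t → Dec (FreeT x t)
freeT? x (var y)  = x ≟ y
freeT? x zer      = no λ ()
freeT? x (S t)    = freeT? x t
freeT? x (s +' t) = freeT? x s ⊎-dec freeT? x t
freeT? x (s · t)  = freeT? x s ⊎-dec freeT? x t

free? : ∀ x φ → Dec (Free x φ)
free? x (s ≐ t)  = freeT? x s ⊎-dec freeT? x t
free? x ⊥'       = no λ ()
free? x (φ ∧' ψ) = free? x φ ⊎-dec free? x ψ
free? x (φ ∨' ψ) = free? x φ ⊎-dec free? x ψ
free? x (φ ⊃ ψ)  = free? x φ ⊎-dec free? x ψ
free? x (∀' φ)   = free? (suc x) φ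
free? x (∃' φ)   = free? (suc x) φ

freeSeq? : ∀ x s → Dec (FreeSeq x s)
freeSeq? x (Γ ⊢ δ) = any? (free? x) Γ ⊎-dec free? x δ

varBoundT : Term → ℕ
varBoundT (var x)  = suc x
varBoundT zer      = 0
varBoundT (S t)    = varBoundT t
varBoundT (s +' t) = varBoundT s ⊔ varBoundT t
varBoundT (s · t)  = varBoundT s ⊔ varBoundT t

varBound : Formula → ℕ
varBound (s ≐ t)  = varBoundT s ⊔ varBoundT t
varBound ⊥'       = 0
varBound (φ ∧' ψ) = varBound φ ⊔ varBound ψ
varBound (φ ∨' ψ) = varBound φ ⊔ varBound ψ
varBound (φ ⊃ ψ)  = varBound φ ⊔ varBound ψ
varBound (∀' φ)   = pred (varBound φ)
varBound (∃' φ)   = pred (varBound φ)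

varBoundL : List Formula → ℕ
varBoundL []      = 0
varBoundL (φ ∷ Γ) = varBound φ ⊔ varBoundL Γ

varBoundSeq : Seq → ℕ
varBoundSeq (Γ ⊢ δ) = varBoundL Γ ⊔ varBound δ

private
  <-⊔ : ∀ {x} m n → x < m ⊎ x < n → x < m ⊔ n
  <-⊔ m n (inj₁ x<m) = <-≤-trans x<m (m≤m⊔n m n)
  <-⊔ m n (inj₂ x<n) = <-≤-trans x<n (m≤n⊔m m n)

  <-pred : ∀ {x} n → suc x < n → x < pred n
  <-pred (suc n) (s≤s x<n) = x<n

freeT⇒<varBoundT : ∀ {x} t → FreeT x t → x < varBoundT t
freeT⇒<varBoundT (var y)  refl = ≤-refl
freeT⇒<varBoundT (S t)    f    = freeT⇒<varBoundT t f
freeT⇒<varBoundT (s +' t) f    = <-⊔ _ _ (map⊎ (freeT⇒<varBoundT s) (freeT⇒<varBoundT t) f)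
freeT⇒<varBoundT (s · t)  f    = <-⊔ _ _ (map⊎ (freeT⇒<varBoundT s) (freeT⇒<varBoundT t) f)

free⇒<varBound : ∀ {x} φ → Free x φ → x < varBound φ
free⇒<varBound (s ≐ t)  f = <-⊔ _ _ (map⊎ (freeT⇒<varBoundT s) (freeT⇒<varBoundT t) f)
free⇒<varBound (φ ∧' ψ) f = <-⊔ _ _ (map⊎ (free⇒<varBound φ) (free⇒<varBound ψ) f)
free⇒<varBound (φ ∨' ψ) f = <-⊔ _ _ (map⊎ (free⇒<varBound φ) (free⇒<varBound ψ) f)
free⇒<varBound (φ ⊃ ψ)  f = <-⊔ _ _ (map⊎ (free⇒<varBound φ) (free⇒<varBound ψ) f)
free⇒<varBound (∀' φ)   f = <-pred (varBound φ) (free⇒<varBound φ f)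
free⇒<varBound (∃' φ)   f = <-pred (varBound φ) (free⇒<varBound φ f)

freeL⇒<varBoundL : ∀ {x} Γ → FreeL x Γ → x < varBoundL Γ
freeL⇒<varBoundL (φ ∷ Γ) (here f)  = <-⊔ _ _ (inj₁ (free⇒<varBound φ f))
freeL⇒<varBoundL (φ ∷ Γ) (there f) = <-⊔ _ _ (inj₂ (freeL⇒<varBoundL Γ f))

freeSeq⇒<varBoundSeq : ∀ {x} s → FreeSeq x s → x < varBoundSeq s
freeSeq⇒<varBoundSeq (Γ ⊢ δ) f = <-⊔ _ _ (map⊎ (freeL⇒<varBoundL Γ) (free⇒<varBound δ) f)

Avoids : Subst → ℕ → Set
Avoids σ y = ∀ z → ¬ FreeT y (σ z)

freeT-rename : ∀ {y} t → FreeT (suc y) (renT suc t) → FreeT y t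
freeT-rename (var x)  e = suc-injective e
freeT-rename (S t)    f = freeT-rename t f
freeT-rename (s +' t) f = map⊎ (freeT-rename s) (freeT-rename t) f
freeT-rename (s · t)  f = map⊎ (freeT-rename s) (freeT-rename t) f

avoids-ext : ∀ {σ y} → Avoids σ y → Avoids (ext σ) (suc y)
avoids-ext     h zero    ()
avoids-ext {σ} h (suc z) f = h z (freeT-rename (σ z) f)

substT-avoids : ∀ {σ y} → Avoids σ y → ∀ t → ¬ FreeT y (substT σ t)
substT-avoids h (var x)  = h x
substT-avoids h zer      = λ ()
substT-avoids h (S t)    = substT-avoids h t
substT-avoids h (s +' t) = [ substT-avoids h s , substT-avoids h t ]′
substT-avoids h (s · t)  = [ substT-avoids h s , substT-avoids h t ]′

substF-avoids : ∀ {σ y} → Avoids σ y → ∀ φ → ¬ Free y (substF σ φ)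
substF-avoids h (s ≐ t)  = [ substT-avoids h s , substT-avoids h t ]′
substF-avoids h ⊥'       = λ ()
substF-avoids h (φ ∧' ψ) = [ substF-avoids h φ , substF-avoids h ψ ]′
substF-avoids h (φ ∨' ψ) = [ substF-avoids h φ , substF-avoids h ψ ]′
substF-avoids h (φ ⊃ ψ)  = [ substF-avoids h φ , substF-avoids h ψ ]′
substF-avoids h (∀' φ)   = substF-avoids (avoids-ext h) φ
substF-avoids h (∃' φ)   = substF-avoids (avoids-ext h) φ

substSeq-avoids : ∀ {σ y} → Avoids σ y → ∀ Γ δ → ¬ FreeSeq y (substL σ Γ ⊢ substF σ δ)
substSeq-avoids h (φ ∷ Γ) δ (inj₁ (here f))  = substF-avoids h φ f
substSeq-avoids h (φ ∷ Γ) δ (inj₁ (there f)) = substSeq-avoids h Γ δ (inj₁ f)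
substSeq-avoids h Γ       δ (inj₂ f)         = substF-avoids h δ f

_[_≔_] : Env → ℕ → ℕ → Env
(ρ [ x ≔ n ]) z with z ≟ x
... | yes _ = n
... | no  _ = ρ z

update-≡ : ∀ ρ x n → (ρ [ x ≔ n ]) x ≡ n
update-≡ ρ x n with x ≟ x
... | yes _   = refl
... | no  x≢x = ⊥-elim (x≢x refl)

update-≢ : ∀ ρ {x z} n → z ≢ x → (ρ [ x ≔ n ]) z ≡ ρ z
update-≢ ρ {x} {z} n z≢x with z ≟ x
... | yes z≡x = ⊥-elim (z≢x z≡x)
... | no  _   = refl

private
  Π-⇔ : {P Q : ℕ → Set} → (∀ n → P n ⇔ Q n) → (∀ n → P n) ⇔ (∀ n → Q n)
  Π-⇔ h = mk⇔ (λ f n → to (h n) (f n)) (λ f n → from (h n) (f n))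

  Σ-⇔ : {P Q : ℕ → Set} → (∀ n → P n ⇔ Q n) → Σ ℕ P ⇔ Σ ℕ Q
  Σ-⇔ h = mk⇔ (λ (n , p) → n , to (h n) p) (λ (n , q) → n , from (h n) q)

  ≡-⇔ : ∀ {a b c d : ℕ} → a ≡ c → b ≡ d → (a ≡ b) ⇔ (c ≡ d)
  ≡-⇔ refl refl = mk⇔ id id

eval-rename : ∀ ρ r t → evalT ρ (renT r t) ≡ evalT (ρ ∘ r) t
eval-rename ρ r (var x)  = refl
eval-rename ρ r zer      = refl
eval-rename ρ r (S t)    = cong suc (eval-rename ρ r t)
eval-rename ρ r (s +' t) = cong₂ _+_ (eval-rename ρ r s) (eval-rename ρ r t)
eval-rename ρ r (s · t)  = cong₂ _*_ (eval-rename ρ r s) (eval-rename ρ r t)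

_≈[_]_on_ : Env → Subst → Env → (ℕ → Set) → Set
ρ ≈[ σ ] ρ̂ on P = ∀ z → P z → evalT ρ (σ z) ≡ ρ̂ z

eval-subst : ∀ {ρ σ ρ̂} t → ρ ≈[ σ ] ρ̂ on (λ z → FreeT z t) → evalT ρ (substT σ t) ≡ evalT ρ̂ t
eval-subst (var x)  h = h x refl
eval-subst zer      h = refl
eval-subst (S t)    h = cong suc (eval-subst t h)
eval-subst (s +' t) h = cong₂ _+_ (eval-subst s (λ z → h z ∘ inj₁)) (eval-subst t (λ z → h z ∘ inj₂))
eval-subst (s · t)  h = cong₂ _*_ (eval-subst s (λ z → h z ∘ inj₁)) (eval-subst t (λ z → h z ∘ inj₂))

≈-ext : ∀ {ρ σ ρ̂} φ n → ρ ≈[ σ ] ρ̂ on (λ z → Free (suc z) φ) →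
        (n ∷ₑ ρ) ≈[ ext σ ] (n ∷ₑ ρ̂) on (λ z → Free z φ)
≈-ext {ρ} {σ} φ n h zero    f = refl
≈-ext {ρ} {σ} φ n h (suc z) f = trans (eval-rename (n ∷ₑ ρ) suc (σ z)) (h z f)

sat-subst : ∀ {ρ σ ρ̂} φ → ρ ≈[ σ ] ρ̂ on (λ z → Free z φ) → Sat ρ (substF σ φ) ⇔ Sat ρ̂ φ
sat-subst (s ≐ t)  h = ≡-⇔ (eval-subst s (λ z → h z ∘ inj₁)) (eval-subst t (λ z → h z ∘ inj₂))
sat-subst ⊥'       h = mk⇔ id id
sat-subst (φ ∧' ψ) h = sat-subst φ (λ z → h z ∘ inj₁) ×-⇔ sat-subst ψ (λ z → h z ∘ inj₂)
sat-subst (φ ∨' ψ) h = sat-subst φ (λ z → h z ∘ inj₁) ⊎-⇔ sat-subst ψ (λ z → h z ∘ inj₂)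
sat-subst (φ ⊃ ψ)  h = →-cong-⇔ (sat-subst φ (λ z → h z ∘ inj₁)) (sat-subst ψ (λ z → h z ∘ inj₂))
sat-subst (∀' φ)   h = Π-⇔ λ n → sat-subst φ (≈-ext φ n h)
sat-subst (∃' φ)   h = Σ-⇔ λ n → sat-subst φ (≈-ext φ n h)

satL-subst : ∀ {ρ σ ρ̂} Γ → ρ ≈[ σ ] ρ̂ on (λ z → FreeL z Γ) →
             All (Sat ρ) (substL σ Γ) ⇔ All (Sat ρ̂) Γ
satL-subst []      h = mk⇔ (λ _ → []) (λ _ → [])
satL-subst (φ ∷ Γ) h =
  mk⇔ (λ { (p ∷ ps) → to head p ∷ to tail ps }) (λ { (p ∷ ps) → from head p ∷ from tail ps })
  where
  head = sat-subst φ (λ z → h z ∘ here)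
  tail = satL-subst Γ (λ z → h z ∘ there)

_≗_on_ : Env → Env → (ℕ → Set) → Set
ρ ≗ ρ' on P = ∀ z → P z → ρ z ≡ ρ' z

eval-coincide : ∀ {ρ ρ'} t → ρ ≗ ρ' on (λ z → FreeT z t) → evalT ρ t ≡ evalT ρ' t
eval-coincide (var x)  h = h x refl
eval-coincide zer      h = refl
eval-coincide (S t)    h = cong suc (eval-coincide t h)
eval-coincide (s +' t) h = cong₂ _+_ (eval-coincide s (λ z → h z ∘ inj₁)) (eval-coincide t (λ z → h z ∘ inj₂))
eval-coincide (s · t)  h = cong₂ _*_ (eval-coincide s (λ z → h z ∘ inj₁)) (eval-coincide t (λ z → h z ∘ inj₂))

≗-cons : ∀ {ρ ρ'} φ n → ρ ≗ ρ' on (λ z → Free (suc z) φ) →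
         (n ∷ₑ ρ) ≗ (n ∷ₑ ρ') on (λ z → Free z φ)
≗-cons φ n h zero    f = refl
≗-cons φ n h (suc z) f = h z f

sat-coincide : ∀ {ρ ρ'} φ → ρ ≗ ρ' on (λ z → Free z φ) → Sat ρ φ ⇔ Sat ρ' φ
sat-coincide (s ≐ t)  h = ≡-⇔ (eval-coincide s (λ z → h z ∘ inj₁)) (eval-coincide t (λ z → h z ∘ inj₂))
sat-coincide ⊥'       h = mk⇔ id id
sat-coincide (φ ∧' ψ) h = sat-coincide φ (λ z → h z ∘ inj₁) ×-⇔ sat-coincide ψ (λ z → h z ∘ inj₂)
sat-coincide (φ ∨' ψ) h = sat-coincide φ (λ z → h z ∘ inj₁) ⊎-⇔ sat-coincide ψ (λ z → h z ∘ inj₂)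
sat-coincide (φ ⊃ ψ)  h = →-cong-⇔ (sat-coincide φ (λ z → h z ∘ inj₁)) (sat-coincide ψ (λ z → h z ∘ inj₂))
sat-coincide (∀' φ)   h = Π-⇔ λ n → sat-coincide φ (≗-cons φ n h)
sat-coincide (∃' φ)   h = Σ-⇔ λ n → sat-coincide φ (≗-cons φ n h)

satL-coincide : ∀ {ρ ρ'} Γ → ρ ≗ ρ' on (λ z → FreeL z Γ) → All (Sat ρ) Γ → All (Sat ρ') Γ
satL-coincide []      h []       = []
satL-coincide (φ ∷ Γ) h (p ∷ ps) =
  to (sat-coincide φ (λ z → h z ∘ here)) p ∷ satL-coincide Γ (λ z → h z ∘ there) ps

-- Local soundness of the rules

_⊨_ : Env → Seq → Set
ρ ⊨ (Γ ⊢ δ) = All (Sat ρ) Γ → Sat ρ δ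

caseVariable : Tag → Maybe ℕ
caseVariable (case x) = just x
caseVariable _        = nothing

record Traced (r : Tag) (s p : Seq) (ρ ρ' : Env) : Set where
  constructor traced
  field
    along : ∀ y → FreeSeq y s → ρ' y ≤ ρ y × (caseVariable r ≡ just y → FreeSeq y p → ρ' y < ρ y)

record PremiseHolds (r : Tag) (s : Seq) (ρ : Env) (p : Seq) : Set where
  constructor premise
  field
    enter : ∀ ρ' → Traced r s p ρ ρ' → ρ' ⊨ p
open PremiseHolds

traced-agree : ∀ {r s p ρ ρ'} → caseVariable r ≡ nothing → ρ' ≗ ρ on (λ y → FreeSeq y s) → Traced r s p ρ ρ'
traced-agree r≢case ρ'≗ρ =
  traced λ y f → ≤-reflexive (ρ'≗ρ y f) , λ r≡case → case-impossible (trans (sym r≢case) r≡case)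
  where
  case-impossible : ∀ {A : Set} {y} → nothing ≡ just y → A
  case-impossible ()

unchanged : ∀ {r s p ρ} → caseVariable r ≡ nothing → PremiseHolds r s ρ p → ρ ⊨ p
unchanged r≢case h = enter h _ (traced-agree r≢case λ _ _ → refl)

update-≗ : ∀ {ρ x n} {P : ℕ → Set} → ¬ P x → (ρ [ x ≔ n ]) ≗ ρ on P
update-≗ {ρ} {n = n} ¬Px z Pz = update-≢ ρ n λ { refl → ¬Px Pz }

≈-inst : ∀ ρ t {P : ℕ → Set} → ρ ≈[ inst0 t ] (evalT ρ t ∷ₑ ρ) on P
≈-inst ρ t zero    _ = refl
≈-inst ρ t (suc z) _ = refl

≈-eigen : ∀ {ρ n y} φ → ¬ Free y (∀' φ) → (ρ [ y ≔ n ]) ≈[ inst0 (var y) ] (n ∷ₑ ρ) on (λ z → Free z φ)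
≈-eigen {ρ} {n} {y} φ y∉φ zero    _ = update-≡ ρ y n
≈-eigen {ρ} {n} {y} φ y∉φ (suc z) f = update-≗ {P = λ z → Free (suc z) φ} y∉φ z f

≈-sub1-zero : ∀ {ρ x} {P : ℕ → Set} → ρ x ≡ 0 → ρ ≈[ sub1 x zer ] ρ on P
≈-sub1-zero {ρ} {x} ρx≡0 z _ with z ≟ x
... | yes refl = sym ρx≡0
... | no  _    = refl

≈-sub1-suc : ∀ {ρ x m} {P : ℕ → Set} → ρ x ≡ suc m → (ρ [ x ≔ m ]) ≈[ sub1 x (S (var x)) ] ρ on P
≈-sub1-suc {ρ} {x} {m} ρx≡1+m z _ with z ≟ x
... | yes refl = trans (cong suc (update-≡ ρ x m)) (sym ρx≡1+m)
... | no  z≢x  = update-≢ ρ m z≢x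

sub1-zero-avoids : ∀ x → Avoids (sub1 x zer) x
sub1-zero-avoids x z f with z ≟ x
... | no z≢x = z≢x (sym f)

sub2-avoids : ∀ {x s y t w} → ¬ FreeT w s → ¬ FreeT w t → w ≡ x ⊎ w ≡ y → Avoids (sub2 x s y t) w
sub2-avoids {x} {s} {y} {t} w∉s w∉t w∈xy z f with z ≟ x
... | yes _ = w∉s f
... | no z≢x with z ≟ y
...   | yes _   = w∉t f
...   | no  z≢y = [ (λ w≡x → z≢x (trans (sym f) w≡x)) , (λ w≡y → z≢y (trans (sym f) w≡y)) ]′ w∈xy

-- Both sides of the eqL rule evaluate alike once x and y both denote the common value of s and t.
≈-eqL : ∀ {ρ x y s t} {P : ℕ → Set} → x ≢ y → evalT ρ s ≡ evalT ρ t →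
        ((ρ [ x ≔ evalT ρ s ]) [ y ≔ evalT ρ s ]) ≈[ sub1 y (var x) ] (evalT ρ ∘ sub2 x s y t) on P
≈-eqL {ρ} {x} {y} {s} {t} x≢y s≡t z _ with z ≟ x
... | yes refl with z ≟ y
...   | yes z≡y = ⊥-elim (x≢y z≡y)
...   | no  z≢y = trans (update-≢ _ _ z≢y) (update-≡ ρ z _)
≈-eqL {ρ} {x} {y} {s} {t} x≢y s≡t z _ | no z≢x with z ≟ y
...   | yes refl = trans (update-≢ _ _ x≢y) (trans (update-≡ ρ x _) s≡t)
...   | no  z≢y  = trans (update-≢ _ _ z≢y) (update-≢ ρ _ z≢x)

eqL-fresh : ∀ {Γ δ x s y t w} → ¬ FreeT w s → ¬ FreeT w t → w ≡ x ⊎ w ≡ y →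
            ¬ FreeSeq w (((s ≐ t) ∷ substL (sub2 x s y t) Γ) ⊢ substF (sub2 x s y t) δ)
eqL-fresh         w∉s w∉t w∈xy (inj₁ (here f))  = [ w∉s , w∉t ]′ f
eqL-fresh {Γ} {δ} w∉s w∉t w∈xy (inj₁ (there f)) = substSeq-avoids (sub2-avoids w∉s w∉t w∈xy) Γ δ (inj₁ f)
eqL-fresh {Γ} {δ} w∉s w∉t w∈xy (inj₂ f)         = substSeq-avoids (sub2-avoids w∉s w∉t w∈xy) Γ δ (inj₂ f)

case-zero-traced : ∀ {Γ δ ρ x} → Traced (case x) (Γ ⊢ δ) (substL (sub1 x zer) Γ ⊢ substF (sub1 x zer) δ) ρ ρ
case-zero-traced {Γ} {δ} {x = x} =
  traced λ y _ → ≤-refl , λ { refl f → ⊥-elim (substSeq-avoids (sub1-zero-avoids x) Γ δ f) }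

case-suc-traced : ∀ {s p ρ x m} → ρ x ≡ suc m → Traced (case x) s p ρ (ρ [ x ≔ m ])
case-suc-traced {ρ = ρ} {x} {m} ρx≡1+m = traced along
  where
  decreases : (ρ [ x ≔ m ]) x < ρ x
  decreases = ≤-reflexive (trans (cong suc (update-≡ ρ x m)) (sym ρx≡1+m))
  along : ∀ y → _ → (ρ [ x ≔ m ]) y ≤ ρ y × (just x ≡ just y → _ → (ρ [ x ≔ m ]) y < ρ y)
  along y _ with x ≟ y
  ... | yes refl = <⇒≤ decreases , λ _ _ → decreases
  ... | no  x≢y  = ≤-reflexive (update-≢ ρ m (x≢y ∘ sym)) , λ { refl _ → ⊥-elim (x≢y refl) }

local-soundness : ∀ {r ps s} → Inst r ps s → ∀ ρ → All (PremiseHolds r s ρ) ps → ρ ⊨ s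
local-soundness ax   ρ [] (a ∷ _) = a
local-soundness botL ρ [] (() ∷ _)
local-soundness eqR  ρ [] _ = refl
local-soundness (eqL {Γ} {δ} {s} {t} {x} {y} x≢y x∉s x∉t y∉s y∉t) ρ (h ∷ []) (s≡t ∷ Γ✓) =
  from (sat-subst δ λ _ _ → refl) (to (sat-subst δ (≈-eqL x≢y s≡t)) (enter h ρ' trace
    (from (satL-subst Γ (≈-eqL x≢y s≡t)) (to (satL-subst Γ λ _ _ → refl) Γ✓))))
  where
  ρ' = (ρ [ x ≔ evalT ρ s ]) [ y ≔ evalT ρ s ]
  fresh = eqL-fresh {Γ} {δ} {x} {s} {y} {t}
  trace = traced-agree refl λ w f →
    trans (update-≗ (fresh y∉s y∉t (inj₂ refl)) w f) (update-≗ (fresh x∉s x∉t (inj₁ refl)) w f)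
local-soundness impL ρ (h₁ ∷ h₂ ∷ []) (f ∷ Γ✓) = unchanged refl h₂ (f (unchanged refl h₁ Γ✓) ∷ Γ✓)
local-soundness impR ρ (h ∷ []) Γ✓ a = unchanged refl h (a ∷ Γ✓)
local-soundness andL ρ (h ∷ []) ((a , b) ∷ Γ✓) = unchanged refl h (a ∷ b ∷ Γ✓)
local-soundness andR ρ (h₁ ∷ h₂ ∷ []) Γ✓ = unchanged refl h₁ Γ✓ , unchanged refl h₂ Γ✓
local-soundness orL  ρ (h₁ ∷ h₂ ∷ []) (inj₁ a ∷ Γ✓) = unchanged refl h₁ (a ∷ Γ✓)
local-soundness orL  ρ (h₁ ∷ h₂ ∷ []) (inj₂ b ∷ Γ✓) = unchanged refl h₂ (b ∷ Γ✓)
local-soundness orR₁ ρ (h ∷ []) Γ✓ = inj₁ (unchanged refl h Γ✓)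
local-soundness orR₂ ρ (h ∷ []) Γ✓ = inj₂ (unchanged refl h Γ✓)
local-soundness (allL {φ = φ} t) ρ (h ∷ []) (g ∷ Γ✓) =
  unchanged refl h (from (sat-subst φ (≈-inst ρ t)) (g (evalT ρ t)) ∷ Γ✓)
local-soundness (allR {Γ} {φ} y y∉Γ y∉φ) ρ (h ∷ []) Γ✓ n =
  to (sat-subst φ (≈-eigen φ y∉φ))
    (enter h (ρ [ y ≔ n ]) (traced-agree refl (update-≗ [ y∉Γ , y∉φ ]′))
       (satL-coincide Γ (λ z f → sym (update-≗ y∉Γ z f)) Γ✓))
local-soundness (exL {Γ} {φ} {δ} y y∉Γ y∉φ y∉δ) ρ (h ∷ []) ((n , a) ∷ Γ✓) =
  to (sat-coincide δ (update-≗ y∉δ))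
    (enter h (ρ [ y ≔ n ]) (traced-agree refl (update-≗ y-fresh))
       (from (sat-subst φ (≈-eigen φ y∉φ)) a ∷ satL-coincide Γ (λ z f → sym (update-≗ y∉Γ z f)) Γ✓))
  where
  y-fresh : ¬ FreeSeq y ((∃' φ ∷ Γ) ⊢ δ)
  y-fresh (inj₁ (here f))  = y∉φ f
  y-fresh (inj₁ (there f)) = y∉Γ f
  y-fresh (inj₂ f)         = y∉δ f
local-soundness (exR {φ = φ} t) ρ (h ∷ []) Γ✓ =
  evalT ρ t , to (sat-subst φ (≈-inst ρ t)) (unchanged refl h Γ✓)
local-soundness (wk Γ⊆Γ') ρ (h ∷ []) Γ'✓ = unchanged refl h (anti-mono Γ⊆Γ' Γ'✓)
local-soundness cut  ρ (h₁ ∷ h₂ ∷ []) Γ✓ = unchanged refl h₂ (unchanged refl h₁ Γ✓ ∷ Γ✓)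
local-soundness zeroNeS ρ [] _ ()
local-soundness sInj ρ [] (Ss≡St ∷ []) = suc-injective Ss≡St
local-soundness (plus0 {s}) ρ [] _ = +-identityʳ (evalT ρ s)
local-soundness (plusS {s} {t}) ρ [] _ = +-suc (evalT ρ s) (evalT ρ t)
local-soundness (times0 {s}) ρ [] _ = *-zeroʳ (evalT ρ s)
local-soundness (timesS {s} {t}) ρ [] _ = trans (*-suc (evalT ρ s) (evalT ρ t)) (+-comm (evalT ρ s) _)
local-soundness (caseR {Γ} {δ} x) ρ (h₀ ∷ h₁ ∷ []) Γ✓ with ρ x in ρx
... | zero  = to (sat-subst δ (≈-sub1-zero ρx))
                (enter h₀ ρ case-zero-traced (from (satL-subst Γ (≈-sub1-zero ρx)) Γ✓))
... | suc m = to (sat-subst δ (≈-sub1-suc ρx))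
                (enter h₁ (ρ [ x ≔ m ]) (case-suc-traced ρx) (from (satL-subst Γ (≈-sub1-suc ρx)) Γ✓))

-- Size-change termination

data Change : Set where
  nonincr decr unknown : Change

infix  4 _≤ᶜ_ _≤ᵍ_
infixr 6 _⊔ᶜ_ _⊔ᵍ_

rank : Change → ℕ
rank nonincr = 0
rank decr    = 1
rank unknown = 2

_≤ᶜ_ : Change → Change → Set
a ≤ᶜ b = rank a ≤ rank b

_⊔ᶜ_ : Change → Change → Change
nonincr ⊔ᶜ b       = b
decr    ⊔ᶜ nonincr = decr
decr    ⊔ᶜ b       = b
unknown ⊔ᶜ _       = unknown

⟦_⟧ : Change → ℕ → ℕ → Set
⟦ nonincr ⟧ m n = n ≤ m
⟦ decr    ⟧ m n = n < m
⟦ unknown ⟧ _ _ = ⊤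

rank-⊔ᶜ : ∀ a b → rank (a ⊔ᶜ b) ≡ rank a ⊔ rank b
rank-⊔ᶜ nonincr b       = refl
rank-⊔ᶜ decr    nonincr = refl
rank-⊔ᶜ decr    decr    = refl
rank-⊔ᶜ decr    unknown = refl
rank-⊔ᶜ unknown nonincr = refl
rank-⊔ᶜ unknown decr    = refl
rank-⊔ᶜ unknown unknown = refl

⊔ᶜ-assoc : ∀ a b c → (a ⊔ᶜ b) ⊔ᶜ c ≡ a ⊔ᶜ (b ⊔ᶜ c)
⊔ᶜ-assoc nonincr b       c       = refl
⊔ᶜ-assoc decr    nonincr c       = refl
⊔ᶜ-assoc decr    decr    nonincr = refl
⊔ᶜ-assoc decr    decr    decr    = refl
⊔ᶜ-assoc decr    decr    unknown = refl
⊔ᶜ-assoc decr    unknown c       = refl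
⊔ᶜ-assoc unknown b       c       = refl

≤ᶜ-reflexive : ∀ {a b} → a ≡ b → a ≤ᶜ b
≤ᶜ-reflexive = ≤-reflexive ∘ cong rank

≤ᶜ-⊔ˡ : ∀ a b → a ≤ᶜ (a ⊔ᶜ b)
≤ᶜ-⊔ˡ a b = ≤-trans (m≤m⊔n (rank a) (rank b)) (≤-reflexive (sym (rank-⊔ᶜ a b)))

≤ᶜ-⊔ʳ : ∀ a b → b ≤ᶜ (a ⊔ᶜ b)
≤ᶜ-⊔ʳ a b = ≤-trans (m≤n⊔m (rank a) (rank b)) (≤-reflexive (sym (rank-⊔ᶜ a b)))

⊔ᶜ-lub : ∀ {a b c} → a ≤ᶜ c → b ≤ᶜ c → (a ⊔ᶜ b) ≤ᶜ c
⊔ᶜ-lub {a} {b} a≤c b≤c = ≤-trans (≤-reflexive (rank-⊔ᶜ a b)) (⊔-lub a≤c b≤c)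

≤ᶜ-unknown : ∀ c → c ≤ᶜ unknown
≤ᶜ-unknown nonincr = z≤n
≤ᶜ-unknown decr    = s≤s z≤n
≤ᶜ-unknown unknown = ≤-refl

⟦⟧-⊔ᶜ : ∀ a b {l m n} → ⟦ a ⟧ l m → ⟦ b ⟧ m n → ⟦ a ⊔ᶜ b ⟧ l n
⟦⟧-⊔ᶜ nonincr nonincr p q = ≤-trans q p
⟦⟧-⊔ᶜ nonincr decr    p q = <-≤-trans q p
⟦⟧-⊔ᶜ nonincr unknown p q = tt
⟦⟧-⊔ᶜ decr    nonincr p q = ≤-<-trans q p
⟦⟧-⊔ᶜ decr    decr    p q = <-trans q p
⟦⟧-⊔ᶜ decr    unknown p q = tt
⟦⟧-⊔ᶜ unknown b       p q = tt

⟦⟧-≤decr : ∀ {c m n} → c ≤ᶜ decr → ⟦ c ⟧ m n → n < m ⊎ (n ≡ m × c ≡ nonincr)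
⟦⟧-≤decr {nonincr} _ n≤m = map⊎ id (_, refl) (m≤n⇒m<n∨m≡n n≤m)
⟦⟧-≤decr {decr}    _ n<m = inj₁ n<m
⟦⟧-≤decr {unknown} (s≤s ()) _

≤ᶜ-antisym-decr : ∀ {c} → decr ≤ᶜ c → c ≤ᶜ decr → c ≡ decr
≤ᶜ-antisym-decr {nonincr} () _
≤ᶜ-antisym-decr {decr}    _  _ = refl
≤ᶜ-antisym-decr {unknown} _  (s≤s ())

-- Size-change graphs relating each variable only to itself: traces follow a single variable.
Graph : ℕ → Set
Graph n = Fin n → Change

_⊔ᵍ_ : ∀ {n} → Graph n → Graph n → Graph n
(σ ⊔ᵍ τ) i = σ i ⊔ᶜ τ i

_≤ᵍ_ : ∀ {n} → Graph n → Graph n → Set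
σ ≤ᵍ τ = ∀ i → σ i ≤ᶜ τ i

_⊨_⇝_ : ∀ {n} → Graph n → (Fin n → ℕ) → (Fin n → ℕ) → Set
τ ⊨ m ⇝ m' = ∀ i → ⟦ τ i ⟧ (m i) (m' i)

weight : ∀ {n} → Graph n → ℕ
weight {zero}  σ = 0
weight {suc n} σ = rank (σ Fin.zero) + weight (σ ∘ Fin.suc)

weight-mono : ∀ {n} {σ τ : Graph n} → σ ≤ᵍ τ → weight σ ≤ weight τ
weight-mono {zero}  σ≤τ = z≤n
weight-mono {suc n} σ≤τ = +-mono-≤ (σ≤τ Fin.zero) (weight-mono (σ≤τ ∘ Fin.suc))

weight-mono-< : ∀ {n} {σ τ : Graph n} → σ ≤ᵍ τ → ∀ i → rank (σ i) < rank (τ i) → weight σ < weight τ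
weight-mono-< {suc n} σ≤τ Fin.zero    lt = +-mono-<-≤ lt (weight-mono (σ≤τ ∘ Fin.suc))
weight-mono-< {suc n} σ≤τ (Fin.suc i) lt = +-mono-≤-< (σ≤τ Fin.zero) (weight-mono-< (σ≤τ ∘ Fin.suc) i lt)

_≤ᵍ?_ : ∀ {n} (τ σ : Graph n) → Dec (τ ≤ᵍ σ)
τ ≤ᵍ? σ = all? λ i → rank (τ i) ≤? rank (σ i)

weight-⊔ᵍ-< : ∀ {n} {σ τ : Graph n} → ¬ τ ≤ᵍ σ → weight σ < weight (σ ⊔ᵍ τ)
weight-⊔ᵍ-< {n} {σ} {τ} τ≰σ =
  let i , τi≰σi = ¬∀⟶∃¬ n _ (λ i → rank (τ i) ≤? rank (σ i)) τ≰σ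
  in weight-mono-< (λ j → ≤ᶜ-⊔ˡ (σ j) (τ j)) i (<-≤-trans (≰⇒> τi≰σi) (≤ᶜ-⊔ʳ (σ i) (τ i)))

-- The size-change principle of Lee, Jones and Ben-Amram, for diagonal graphs.
module SizeChange {n : ℕ} (Realised : Graph n → Set)
                  (⊔-closed : ∀ {σ τ} → Realised σ → Realised τ → Realised (σ ⊔ᵍ τ))
                  (has-decr : ∀ {σ} → Realised σ → ∃[ i ] σ i ≡ decr) where

  Descent : (Fin n → ℕ) → (Fin n → ℕ) → Set
  Descent m' m = ∃[ τ ] (Realised τ × τ ⊨ m ⇝ m')

  DescentBelow : Graph n → (Fin n → ℕ) → (Fin n → ℕ) → Set
  DescentBelow κ m' m = ∃[ τ ] (Realised τ × τ ≤ᵍ κ × τ ⊨ m ⇝ m')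

  private
    freeze : Graph n → Fin n → Graph n
    freeze σ x i with i Fin.≟ x
    ... | yes _ = nonincr
    ... | no  _ = σ i

    freeze-≤ : ∀ {σ κ} x → σ ≤ᵍ κ → freeze σ x ≤ᵍ κ
    freeze-≤ x σ≤κ i with i Fin.≟ x
    ... | yes _ = z≤n
    ... | no  _ = σ≤κ i

    freeze-< : ∀ {σ κ} x → σ ≤ᵍ κ → σ x ≡ decr → weight (freeze σ x) < weight κ
    freeze-< {σ} {κ} x σ≤κ σx≡decr = weight-mono-< (freeze-≤ x σ≤κ) x at-x
      where
      at-x : rank (freeze σ x x) < rank (κ x)
      at-x with x Fin.≟ x
      ... | yes _   = ≤-trans (≤ᶜ-reflexive (sym σx≡decr)) (σ≤κ x)
      ... | no  x≢x = ⊥-elim (x≢x refl)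

    ≤-freeze : ∀ {τ σ} x → τ ≤ᵍ σ → τ x ≡ nonincr → τ ≤ᵍ freeze σ x
    ≤-freeze x τ≤σ τx≡nonincr i with i Fin.≟ x
    ... | yes refl = ≤ᶜ-reflexive τx≡nonincr
    ... | no  _    = τ≤σ i

    -- A step by a graph τ ≰ σ moves on to the strictly larger realised graph σ ⊔ τ, which can
    -- happen only finitely often. Steps by graphs below σ never increase the variable x that σ
    -- decreases; while x keeps its value they are bounded by σ frozen at x, of smaller weight.
    from-realised : ∀ κ → (∀ κ' → weight κ' < weight κ → WellFounded (DescentBelow κ')) →
                    ∀ {σ} → Realised σ → σ ≤ᵍ κ → Acc _<_ (weight κ ∸ weight σ) →
                    WellFounded (DescentBelow κ)
    from-realised κ below-κ {σ} rσ σ≤κ (acc larger) m = descend (<-wellFounded (m x)) m refl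
      where
      x = proj₁ (has-decr rσ)
      frozen = below-κ (freeze σ x) (freeze-< x σ≤κ (proj₂ (has-decr rσ)))

      hold : ∀ {k} → (∀ {m'} → m' x < k → Acc (DescentBelow κ) m') →
             ∀ m → m x ≡ k → Acc (DescentBelow (freeze σ x)) m → Acc (DescentBelow κ) m
      hold {k} shrink m mx≡k (acc within) = acc λ { (τ , rτ , τ≤κ , τ⊨) → step τ rτ τ≤κ τ⊨ (τ ≤ᵍ? σ) }
        where
        step : ∀ {m'} τ → Realised τ → τ ≤ᵍ κ → τ ⊨ m ⇝ m' → Dec (τ ≤ᵍ σ) → Acc (DescentBelow κ) m'
        step {m'} τ rτ τ≤κ τ⊨ (no τ≰σ) =
          from-realised κ below-κ (⊔-closed rσ rτ) (λ i → ⊔ᶜ-lub (σ≤κ i) (τ≤κ i)) (larger gap) m'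
          where
          gap : weight κ ∸ weight (σ ⊔ᵍ τ) < weight κ ∸ weight σ
          gap = ∸-monoʳ-< (weight-⊔ᵍ-< τ≰σ) (weight-mono λ i → ⊔ᶜ-lub (σ≤κ i) (τ≤κ i))
        step {m'} τ rτ τ≤κ τ⊨ (yes τ≤σ)
          with ⟦⟧-≤decr (≤-trans (τ≤σ x) (≤ᶜ-reflexive (proj₂ (has-decr rσ)))) (τ⊨ x)
        ... | inj₁ m'x<mx = shrink (<-≤-trans m'x<mx (≤-reflexive mx≡k))
        ... | inj₂ (m'x≡mx , τx≡nonincr) =
          hold shrink m' (trans m'x≡mx mx≡k) (within (τ , rτ , ≤-freeze x τ≤σ τx≡nonincr , τ⊨))

      descend : ∀ {k} → Acc _<_ k → ∀ m → m x ≡ k → Acc (DescentBelow κ) m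
      descend (acc below) m mx≡k = hold (λ {m'} lt → descend (below lt) m' refl) m mx≡k (frozen m)

  descentBelow-wellFounded : ∀ κ → Acc _<_ (weight κ) → WellFounded (DescentBelow κ)
  descentBelow-wellFounded κ (acc smaller) m = acc λ { (σ , rσ , σ≤κ , _) →
    from-realised κ (λ κ' lt → descentBelow-wellFounded κ' (smaller lt)) rσ σ≤κ (<-wellFounded _) _ }

  descent-wellFounded : WellFounded Descent
  descent-wellFounded = Subrelation.wellFounded (λ (τ , rτ , τ⊨) → τ , rτ , ≤ᶜ-unknown ∘ τ , τ⊨)
    (descentBelow-wellFounded (λ _ → unknown) (<-wellFounded _))

-- The vertices are eliminated one at a time: leaving u, a path stays within U until it returns to u.
module LoopElimination {V X : Set} (_≟ᵥ_ : DecidableEquality V) (_⟶_ : V × X → V × X → Set) where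

  Loop : V → X → X → Set
  Loop u y x = TransClosure _⟶_ (u , x) (u , y)

  Within : List V → V × X → V × X → Set
  Within U q p = p ⟶ q × proj₁ p ∈ U × proj₁ q ∈ U

  private
    drop : ∀ {u v : V} {U} → v ∈ u ∷ U → v ≢ u → v ∈ U
    drop (here refl) v≢u = ⊥-elim (v≢u refl)
    drop (there v∈U) _   = v∈U

    module Eliminate (u : V) (U : List V) (within-wf : WellFounded (Within U)) where

      off-u : ∀ {b y} → b ≢ u → Acc (Within U) (b , y) →
              (∀ {z} → TransClosure _⟶_ (b , y) (u , z) → Acc (Within (u ∷ U)) (u , z)) →
              Acc (Within (u ∷ U)) (b , y)
      off-u {b} {y} b≢u (acc rs) reach-u = acc λ { (st , b∈ , c∈) → next st b∈ c∈ (_ ≟ᵥ u) }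
        where
        next : ∀ {c z} → (b , y) ⟶ (c , z) → b ∈ u ∷ U → c ∈ u ∷ U → Dec (c ≡ u) →
               Acc (Within (u ∷ U)) (c , z)
        next st b∈ c∈ (yes refl) = reach-u [ st ]
        next st b∈ c∈ (no c≢u)   = off-u c≢u (rs (st , drop b∈ b≢u , drop c∈ c≢u)) (reach-u ∘ (st ∷_))

      at-u : ∀ {x} → Acc (Loop u) x → Acc (Within (u ∷ U)) (u , x)
      at-u {x} (acc rs) = acc λ { (st , _ , _) → next st (_ ≟ᵥ u) }
        where
        next : ∀ {c z} → (u , x) ⟶ (c , z) → Dec (c ≡ u) → Acc (Within (u ∷ U)) (c , z)
        next st (yes refl) = at-u (rs [ st ])
        next st (no c≢u)   = off-u c≢u (within-wf _) (at-u ∘ rs ∘ (st ∷_))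

  within-wellFounded : (∀ u → WellFounded (Loop u)) → ∀ U → WellFounded (Within U)
  within-wellFounded loop-wf []      p       = acc λ { (_ , () , _) }
  within-wellFounded loop-wf (u ∷ U) (a , x) = start (a ≟ᵥ u)
    where
    open Eliminate u U (within-wellFounded loop-wf U)
    start : Dec (a ≡ u) → Acc (Within (u ∷ U)) (a , x)
    start (yes refl) = at-u (loop-wf u x)
    start (no a≢u)   = off-u a≢u (within-wellFounded loop-wf U (a , x)) (λ _ → at-u (loop-wf u _))

  wellFounded : (∀ u → WellFounded (Loop u)) → ∀ U → (∀ {p q} → p ⟶ q → proj₁ q ∈ U) →
                WellFounded (flip _⟶_)
  wellFounded loop-wf U covers p = acc λ p⟶q → inside (within-wellFounded loop-wf U _) (covers p⟶q)
    where
    inside : ∀ {q} → Acc (Within U) q → proj₁ q ∈ U → Acc (flip _⟶_) q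
    inside (acc rs) q∈U = acc λ q⟶r → inside (rs (q⟶r , q∈U , covers q⟶r)) (covers q⟶r)

mutual
  at-++ : ∀ t a b {t'} → at t a ≡ just t' → at t (a ++ b) ≡ at t' b
  at-++ t             []      b refl = refl
  at-++ (node _ _ ts) (j ∷ a) b eq   = atList-++ ts j a b eq

  atList-++ : ∀ ts j a b {t'} → atList ts j a ≡ just t' → atList ts j (a ++ b) ≡ at t' b
  atList-++ (t ∷ ts) zero    a b eq = at-++ t a b eq
  atList-++ (t ∷ ts) (suc j) a b eq = atList-++ ts j a b eq

mutual
  wf-at : ∀ {root t t'} a → WF root t → at t a ≡ just t' → WF root t'
  wf-at []      w             refl = w
  wf-at (j ∷ a) (nodeWF _ ws) eq   = wf-atList j a ws eq

  wf-atList : ∀ {root ts t'} j a → All (WF root) ts → atList ts j a ≡ just t' → WF root t'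
  wf-atList zero    a (w ∷ _)  eq = wf-at a w eq
  wf-atList (suc j) a (_ ∷ ws) eq = wf-atList j a ws eq

mutual
  addresses : PTree → List Address
  addresses (bud _ _)     = [] ∷ []
  addresses (node _ _ ts) = [] ∷ addressesFrom 0 ts

  addressesFrom : ℕ → List PTree → List Address
  addressesFrom j []       = []
  addressesFrom j (t ∷ ts) = map (j ∷_) (addresses t) ++ addressesFrom (suc j) ts

mutual
  addresses-complete : ∀ t a {t'} → at t a ≡ just t' → a ∈ addresses t
  addresses-complete (bud _ _)     []      _  = here refl
  addresses-complete (node _ _ _)  []      _  = here refl
  addresses-complete (node _ _ ts) (j ∷ a) eq = there (addressesFrom-complete 0 ts j a eq)

  addressesFrom-complete : ∀ k ts j a {t'} → atList ts j a ≡ just t' → (k + j ∷ a) ∈ addressesFrom k ts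
  addressesFrom-complete k (t ∷ ts) zero a eq rewrite +-identityʳ k =
    ∈-++⁺ˡ (∈-map⁺ (k ∷_) (addresses-complete t a eq))
  addressesFrom-complete k (t ∷ ts) (suc j) a eq rewrite +-suc k j =
    ∈-++⁺ʳ (map (k ∷_) (addresses t)) (addressesFrom-complete (suc k) ts j a eq)

children : ∀ {P : PTree → Set} ts → (∀ j {t} → atList ts j [] ≡ just t → P t) → All P ts
children []       f = []
children (t ∷ ts) f = f 0 refl ∷ children ts (λ j → f (suc j))

classify : ∀ {A B : Set} → Dec A → Dec B → Change
classify (no _)  _       = unknown
classify (yes _) (yes _) = decr
classify (yes _) (no _)  = nonincr

classify-sound : ∀ {A B : Set} (A? : Dec A) (B? : Dec B) {m n} →
                 (A → n ≤ m × (B → n < m)) → ⟦ classify A? B? ⟧ m n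
classify-sound (no _)  _       h = tt
classify-sound (yes a) (yes b) h = proj₂ (h a) b
classify-sound (yes a) (no _)  h = proj₁ (h a)

classify-≤decr : ∀ {A B : Set} (A? : Dec A) (B? : Dec B) → A → classify A? B? ≤ᶜ decr
classify-≤decr (no ¬a) _      a = ⊥-elim (¬a a)
classify-≤decr (yes _) (yes _) _ = ≤-refl
classify-≤decr (yes _) (no _)  _ = z≤n

classify-decr : ∀ {A B : Set} (A? : Dec A) (B? : Dec B) → A → B → classify A? B? ≡ decr
classify-decr (no ¬a) _       a b = ⊥-elim (¬a a)
classify-decr (yes _) (yes _) a b = refl
classify-decr (yes _) (no ¬b) a b = ⊥-elim (¬b b)

caseVariableOf : PTree → Maybe ℕ
caseVariableOf (bud _ _)    = nothing
caseVariableOf (node _ r _) = caseVariable r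

module Cycles (π : PTree) where

  _↝_ : Address → Address → Set
  _↝_ = Next π

  Reach : Address → Set
  Reach = Star _↝_ []

  FreeAt : Address → ℕ → Set
  FreeAt a y = MaybeAny.Any (FreeSeq y ∘ label) (at π a)

  CaseAt : Address → ℕ → Set
  CaseAt a y = MaybeAny.Any (λ t → caseVariableOf t ≡ just y) (at π a)

  freeAt? : ∀ a y → Dec (FreeAt a y)
  freeAt? a y = MaybeAny.dec (freeSeq? y ∘ label) (at π a)

  caseAt? : ∀ a y → Dec (CaseAt a y)
  caseAt? a y = MaybeAny.dec (λ t → ≡-dec _≟_ (caseVariableOf t) (just y)) (at π a)

  edgeChange : Address → Address → ℕ → Change
  edgeChange a b y = classify (freeAt? a y) (caseAt? a y ×-dec freeAt? b y)

  pathChange : ∀ {a b} → TransClosure _↝_ a b → ℕ → Change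
  pathChange ([_] {a} {b} _)   y = edgeChange a b y
  pathChange (_∷_ {a} {b} _ w) y = edgeChange a b y ⊔ᶜ pathChange w y

  pathChange-++ : ∀ {a b c} (v : TransClosure _↝_ a b) (w : TransClosure _↝_ b c) y →
                  pathChange (v ++⁺ w) y ≡ pathChange v y ⊔ᶜ pathChange w y
  pathChange-++ [ _ ]   w y = refl
  pathChange-++ (_∷_ {a} {b} _ v) w y =
    trans (cong (edgeChange a b y ⊔ᶜ_) (pathChange-++ v w y)) (sym (⊔ᶜ-assoc (edgeChange a b y) (pathChange v y) _))

  module Lasso {u} (c : TransClosure _↝_ u u) where

    around : ∀ {a} → TransClosure _↝_ a u → ℕ → Address
    around {a} _       zero    = a
    around     [ _ ]   (suc i) = around c i
    around     (_ ∷ w) (suc i) = around w i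

    lasso : ∀ {a} → Star _↝_ a u → ℕ → Address
    lasso {a} _       zero    = a
    lasso     ε       (suc i) = around c (suc i)
    lasso     (_ ◅ w) (suc i) = lasso w i

    around-↝ : ∀ {a} (w : TransClosure _↝_ a u) i → around w i ↝ around w (suc i)
    around-↝ [ e ]   zero    = e
    around-↝ [ e ]   (suc i) = around-↝ c i
    around-↝ (e ∷ w) zero    = e
    around-↝ (e ∷ w) (suc i) = around-↝ w i

    lasso-↝ : ∀ {a} (w : Star _↝_ a u) i → lasso w i ↝ lasso w (suc i)
    lasso-↝ ε       zero    = around-↝ c zero
    lasso-↝ ε       (suc i) = around-↝ c (suc i)
    lasso-↝ (e ◅ w) zero    = e
    lasso-↝ (e ◅ w) (suc i) = lasso-↝ w i

    around-period : ∀ {a} (w : TransClosure _↝_ a u) → ∃[ k ] (∀ i → around w (suc k + i) ≡ around c i)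
    around-period [ _ ]   = 0 , λ _ → refl
    around-period (_ ∷ w) = let k , h = around-period w in suc k , h

    lasso-shift : ∀ {a} (w : Star _↝_ a u) → ∃[ k ] (∀ i → lasso w (k + i) ≡ around c i)
    lasso-shift ε       = 0 , λ { zero → refl ; (suc i) → refl }
    lasso-shift (_ ◅ w) = let k , h = lasso-shift w in suc k , h

    around-late : ∀ N i → ∃[ j ] (N ≤ j × around c j ≡ around c i)
    around-late zero    i = i , z≤n , refl
    around-late (suc N) i =
      let j , N≤j , eq = around-late N i
          k , period   = around-period c
      in suc k + j , s≤s (≤-trans N≤j (m≤n+m j k)) , trans (period j) eq

    around-≤ : ∀ {a y} (w : TransClosure _↝_ a u) i →
               edgeChange (around w i) (around w (suc i)) y ≤ᶜ pathChange w y ⊔ᶜ pathChange c y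
    around-≤ {y = y} [ e ] zero = ≤ᶜ-⊔ˡ _ (pathChange c y)
    around-≤ {y = y} [ e ] (suc i) =
      ≤-trans (around-≤ c i) (⊔ᶜ-lub (≤ᶜ-⊔ʳ _ (pathChange c y)) (≤ᶜ-⊔ʳ _ (pathChange c y)))
    around-≤ {y = y} (e ∷ w) zero =
      ≤-trans (≤ᶜ-⊔ˡ _ (pathChange w y)) (≤ᶜ-⊔ˡ _ (pathChange c y))
    around-≤ {y = y} (_∷_ {a} {b} e w) (suc i) =
      ≤-trans (around-≤ w i)
        (⊔ᶜ-lub (≤-trans (≤ᶜ-⊔ʳ (edgeChange a b y) (pathChange w y)) (≤ᶜ-⊔ˡ _ (pathChange c y)))
                (≤ᶜ-⊔ʳ _ (pathChange c y)))

    pathChange-≤decr : ∀ {a y} (w : TransClosure _↝_ a u) → (∀ i → FreeAt (around w i) y) → pathChange w y ≤ᶜ decr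
    pathChange-≤decr {a} {y} [ _ ]   free = classify-≤decr (freeAt? a y) _ (free 0)
    pathChange-≤decr {a} {y} (_ ∷ w) free =
      ⊔ᶜ-lub {c = decr} (classify-≤decr (freeAt? a y) _ (free 0)) (pathChange-≤decr w (free ∘ suc))

  -- Apply the global trace condition to the branch that walks to u and then goes round c forever.
  cycle-decreases : (∀ f → InfBranch π f → GoodBranch π f) →
                    ∀ {u} → Reach u → (c : TransClosure _↝_ u u) → ∃[ y ] (FreeAt u y × pathChange c y ≡ decr)
  cycle-decreases good {u} w c = from-trace (good (lasso w) (refl , lasso-↝ w))
    where
    open Lasso c
    k = proj₁ (lasso-shift w)
    shift = proj₂ (lasso-shift w)

    from-trace : GoodBranch π (lasso w) → ∃[ y ] (FreeAt u y × pathChange c y ≡ decr)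
    from-trace (x , (N , frees) , cases) =
      x , on-cycle 0 , ≤ᶜ-antisym-decr {pathChange c x} decr≤ (pathChange-≤decr c on-cycle)
      where
      on-cycle : ∀ j → FreeAt (around c j) x
      on-cycle j with around-late N j
      ... | j' , N≤j' , eq with frees (k + j') (≤-trans N≤j' (m≤n+m j' k))
      ...   | t , at≡t , free =
        subst (λ b → FreeAt b x) (trans (shift j') eq) (subst (MaybeAny.Any _) (sym at≡t) (just free))

      case-on-cycle : ∃[ j ] CaseAt (around c j) x
      case-on-cycle with cases (k + N)
      ... | i , k+N≤i , _ , _ , at≡case with m≤n⇒∃[o]m+o≡n (≤-trans (m≤m+n k N) k+N≤i)
      ...   | j , k+j≡i = j , subst (λ b → CaseAt b x) (trans (cong (lasso w) (sym k+j≡i)) (shift j))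
                                 (subst (MaybeAny.Any _) (sym at≡case) (just refl))

      decr≤ : decr ≤ᶜ pathChange c x
      decr≤ = let j , case-at-j = case-on-cycle in
        ≤-trans (≤ᶜ-reflexive (sym (classify-decr (freeAt? (around c j) x) _ (on-cycle j) (case-at-j , on-cycle (suc j)))))
                (≤-trans (around-≤ c j) (⊔ᶜ-lub ≤-refl ≤-refl))

module Soundness (π : PTree) (wfπ : WF π π) (good : ∀ f → InfBranch π f → GoodBranch π f) where
  open Cycles π

  State : Set
  State = Address × Env

  -- Sources must be reachable because the trace condition only speaks about branches from the root.
  _⟶_ : State → State → Set
  (a , ρ) ⟶ (b , ρ') = Reach a × a ↝ b × (∀ y → ⟦ edgeChange a b y ⟧ (ρ y) (ρ' y))

  open LoopElimination (≡-decᴸ _≟_) _⟶_ using (Loop; wellFounded)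

  ↝-target : ∀ {a b} → a ↝ b → ∃[ t ] at π b ≡ just t
  ↝-target (inj₁ (_ , _ , t , eq)) = t , eq
  ↝-target {a} (inj₂ (s , eq)) with wf-at a wfπ eq
  ... | budWF (_ , _ , _ , companion) = _ , companion

  path-change : ∀ {a b ρ ρ'} → TransClosure _⟶_ (a , ρ) (b , ρ') →
                Reach a × Σ (TransClosure _↝_ a b) λ c → ∀ y → ⟦ pathChange c y ⟧ (ρ y) (ρ' y)
  path-change [ r , e , ch ]       = r , [ e ] , ch
  path-change ((r , e , ch) ∷ st⁺) =
    let _ , c , ch⁺ = path-change st⁺ in r , e ∷ c , λ y → ⟦⟧-⊔ᶜ _ (pathChange c y) (ch y) (ch⁺ y)

  varBoundAt : Address → ℕ
  varBoundAt a = maybe (varBoundSeq ∘ label) 0 (at π a)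

  freeAt⇒<varBoundAt : ∀ {a y} → FreeAt a y → y < varBoundAt a
  freeAt⇒<varBoundAt {a} = bounded (at π a)
    where
    bounded : ∀ {y} m → MaybeAny.Any (FreeSeq y ∘ label) m → y < maybe (varBoundSeq ∘ label) 0 m
    bounded (just t) (just f) = freeSeq⇒<varBoundSeq (label t) f

  Realised : (u : Address) → Graph (varBoundAt u) → Set
  Realised u τ = Reach u × Σ (TransClosure _↝_ u u) λ c → ∀ i → τ i ≡ pathChange c (toℕ i)

  realised-⊔ : ∀ {u σ τ} → Realised u σ → Realised u τ → Realised u (σ ⊔ᵍ τ)
  realised-⊔ (r , c , σ≡) (_ , c' , τ≡) =
    r , c ++⁺ c' , λ i → trans (cong₂ _⊔ᶜ_ (σ≡ i) (τ≡ i)) (sym (pathChange-++ c c' (toℕ i)))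

  realised-decr : ∀ {u τ} → Realised u τ → ∃[ i ] τ i ≡ decr
  realised-decr {u} {τ} (r , c , τ≡) =
    let y , free , decreases = cycle-decreases good r c
        y<bound = freeAt⇒<varBoundAt {u} free
    in fromℕ< y<bound , trans (τ≡ _) (trans (cong (pathChange c) (toℕ-fromℕ< y<bound)) decreases)

  loops-wellFounded : ∀ u → WellFounded (Loop u)
  loops-wellFounded u = Subrelation.wellFounded descends (On.wellFounded restrict descent-wellFounded)
    where
    open SizeChange (Realised u) realised-⊔ realised-decr
    restrict : Env → Fin (varBoundAt u) → ℕ
    restrict ρ i = ρ (toℕ i)
    descends : ∀ {ρ'' ρ} → Loop u ρ'' ρ → (Descent on restrict) ρ'' ρ
    descends loop = let r , c , ch = path-change loop in (λ i → pathChange c (toℕ i)) , (r , c , λ _ → refl) , ch ∘ toℕ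

  states-wellFounded : WellFounded (flip _⟶_)
  states-wellFounded = wellFounded loops-wellFounded (addresses π)
    λ (_ , e , _) → addresses-complete π _ (proj₂ (↝-target e))

  freeAt⇒ : ∀ {a t y} → at π a ≡ just t → FreeAt a y → FreeSeq y (label t)
  freeAt⇒ eq f = drop-just (subst (MaybeAny.Any _) eq f)

  caseAt⇒ : ∀ {a t y} → at π a ≡ just t → CaseAt a y → caseVariableOf t ≡ just y
  caseAt⇒ eq c = drop-just (subst (MaybeAny.Any _) eq c)

  traced⇒edgeChange : ∀ {a b s r ts t ρ ρ'} → at π a ≡ just (node s r ts) → at π b ≡ just t →
                      Traced r s (label t) ρ ρ' → ∀ y → ⟦ edgeChange a b y ⟧ (ρ y) (ρ' y)
  traced⇒edgeChange {a} {b} eqa eqb (traced along) y =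
    classify-sound (freeAt? a y) (caseAt? a y ×-dec freeAt? b y) λ fa →
      let le , lt = along y (freeAt⇒ {a} eqa fa) in le , λ (ca , fb) → lt (caseAt⇒ {a} eqa ca) (freeAt⇒ {b} eqb fb)

  bud⇒edgeChange : ∀ {a b s} {ρ : Env} → at π a ≡ just (bud s b) → ∀ y → ⟦ edgeChange a b y ⟧ (ρ y) (ρ y)
  bud⇒edgeChange {a} {b} {ρ = ρ} eq y =
    classify-sound (freeAt? a y) (caseAt? a y ×-dec freeAt? b y) λ _ →
      ≤-refl , λ (ca , _) → no-case (caseAt⇒ {a} eq ca)
    where
    no-case : ∀ {A : Set} → nothing ≡ just y → A
    no-case ()

  valid : ∀ {a t} ρ → Acc (flip _⟶_) (a , ρ) → Reach a → at π a ≡ just t → ρ ⊨ label t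
  valid {a} ρ (acc next) r eq with wf-at a wfπ eq
  ... | budWF (_ , _ , _ , companion) =
    valid ρ (next (r , e , bud⇒edgeChange {a} eq)) (r ◅◅ (e ◅ ε)) companion
    where e = inj₂ (_ , eq)
  ... | nodeWF {ts = ts} inst _ = local-soundness inst ρ (All-map⁺ (children ts premise-holds))
    where
    premise-holds : ∀ j {t} → atList ts j [] ≡ just t → PremiseHolds _ _ ρ (label t)
    premise-holds j eqⱼ = premise λ ρ' tr →
      valid ρ' (next (r , e , traced⇒edgeChange {a} {a ++ j ∷ []} eq eqb tr)) (r ◅◅ (e ◅ ε)) eqb
      where
      eqb = trans (at-++ π a (j ∷ []) eq) eqⱼ
      e = inj₁ (j , refl , _ , eqb)

  root-valid : ∀ ρ → ρ ⊨ label π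
  root-valid ρ = valid ρ (states-wellFounded ([] , ρ)) ε refl

proposition2p6 : (Γ : List Formula) (δ : Formula) → Γ ⊢CHA δ → Γ ⊨ω δ
proposition2p6 Γ δ (π , root , wfπ , good) ρ = subst (ρ ⊨_) root (Soundness.root-valid π wfπ good ρ)
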